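{- Let $a,b$ be arbitrary distinct elements of ${\mathbb L}$. Then the structure $(\{0,1\};\mathrm{NAE})$, where $\mathrm{NAE}=\{0,1\}^3\setminus\{(0,0,0),(1,1,1)\}$, has a primitive positive interpretation in the structure $({\mathbb L};N,a,b)$ (the expansion of $({\mathbb L};N)$ by the two constants $a$ and $b$).
   Context: Let $({\mathbb L};C)$ denote the homogeneous binary branching C-relation: ${\mathbb L}$ is a countably infinite set and $({\mathbb L};C)$ is the (up to isomorphism unique) countable homogeneous structure whose finite substructures are, up to isomorphism, exactly the structures $(L;C^T)$ where $T$ is a finite rooted binary tree (every inner vertex has exactly two children) with leaf set $L$, and $C^T(x,y,z)$ holds iff the youngest common ancestor of $y$ and $z$ is a proper descendant of the youngest common ancestor of $x,y,z$. One writes $x|yz$ and also $yz|x$ for $C(x,y,z)$. The ternary relation $N$ on ${\mathbb L}$ is defined by $N(x,y,z) \Leftrightarrow (xy|z \vee x|yz)$. A relational $\sigma$-structure $\Delta$ has a primitive positive interpretation in a $\tau$-structure $\Gamma$ if there exist a natural number $d$, a primitive positive $\tau$-formula $\delta(x_1,\dots,x_d)$ (domain formula), for each atomic $\sigma$-formula $\phi(y_1,\dots,y_k)$ (including equality) a primitive positive $\tau$-formula $\phi_I(\bar x_1,\dots,\bar x_k)$ where the $\bar x_i$ are disjoint $d$-tuples of distinct variables, and a surjective map $h$ from the set of $d$-tuples of elements of $\Gamma$ satisfying $\delta$ onto the domain of $\Delta$, such that for all atomic $\sigma$-formulas $\phi$ and all tuples $\bar a_1,\dots,\bar a_k$ in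 the domain of $h$: $\Delta\models\phi(h(\bar a_1),\dots,h(\bar a_k))$ iff $\Gamma\models\phi_I(\bar a_1,\dots,\bar a_k)$. In an expansion by constants, the constants may be used in these formulas. -}

module Defs where

open import Data.Nat using (ℕ)
import Data.Nat as ℕ
open import Data.Fin using (Fin; zero; suc)
open import Data.Bool using (Bool; true; false)
open import Data.Unit using (⊤; tt)
open import Data.Empty using (⊥)
open import Data.Sum using (_⊎_; inj₁; inj₂)
open import Data.Product using (Σ; Σ-syntax; ∃; ∃-syntax; _×_; _,_; proj₁)
open import Data.List using (List)
open import Data.List.Relation.Unary.All using (All)
open import Function.Bundles using (_↔_; _⇔_; Inverse)
open import Function.Definitions using (Injective; Surjective)
open import Relation.Binary.PropositionalEquality using (_≡_; _≢_)
open import Relation.Nullary using (¬_)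

data Tree : Set where
  leaf : Tree
  node : Tree → Tree → Tree

Leaf : Tree → Set
Leaf leaf       = ⊤
Leaf (node l r) = Leaf l ⊎ Leaf r

-- C^T(x,y,z): the youngest common ancestor of y and z is a proper
-- descendant of the youngest common ancestor of x, y, z.
CT : (T : Tree) → Leaf T → Leaf T → Leaf T → Set
CT leaf       _        _        _        = ⊥
CT (node l r) (inj₁ x) (inj₁ y) (inj₁ z) = CT l x y z
CT (node l r) (inj₂ x) (inj₁ y) (inj₁ z) = ⊤
CT (node l r) (inj₁ x) (inj₂ y) (inj₂ z) = ⊤
CT (node l r) (inj₂ x) (inj₂ y) (inj₂ z) = CT r x y z
CT (node l r) _        _        _        = ⊥

Rel3 : Set → Set₁
Rel3 L = L → L → L → Set

AgeInTrees : (L : Set) → Rel3 L → Set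
AgeInTrees L C =
  ∀ n (f : Fin (ℕ.suc n) → L) → Injective _≡_ _≡_ f →
  Σ[ T ∈ Tree ] Σ[ g ∈ (Fin (ℕ.suc n) ↔ Leaf T) ]
    (∀ i j k → C (f i) (f j) (f k) ⇔
               CT T (Inverse.to g i) (Inverse.to g j) (Inverse.to g k))

TreesInAge : (L : Set) → Rel3 L → Set
TreesInAge L C =
  ∀ (T : Tree) → Σ[ e ∈ (Leaf T → L) ] Injective _≡_ _≡_ e ×
    (∀ x y z → CT T x y z ⇔ C (e x) (e y) (e z))

Homogeneous : (L : Set) → Rel3 L → Set
Homogeneous L C =
  ∀ n (f g : Fin n → L) → Injective _≡_ _≡_ f → Injective _≡_ _≡_ g →
  (∀ i j k → C (f i) (f j) (f k) ⇔ C (g i) (g j) (g k)) →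
  Σ[ α ∈ (L ↔ L) ]
    ((∀ x y z → C x y z ⇔ C (Inverse.to α x) (Inverse.to α y) (Inverse.to α z)) ×
     (∀ i → Inverse.to α (f i) ≡ g i))

record IsHomBinBranchingC (L : Set) (C : Rel3 L) : Set where
  field
    countablyInfinite : ℕ ↔ L
    ageInTrees        : AgeInTrees L C
    treesInAge        : TreesInAge L C
    homogeneous       : Homogeneous L C

-- N(x,y,z) :⇔ xy|z ∨ x|yz, where x|yz means C(x,y,z) and xy|z means C(z,x,y)
N : {L : Set} → Rel3 L → Rel3 L
N C x y z = C z x y ⊎ C x y z

data Term (V : Set) : Set where
  var  : V → Term V
  cstA : Term V
  cstB : Term V

data Atom (V : Set) : Set where
  eq  : Term V → Term V → Atom V
  rel : Term V → Term V → Term V → Atom V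

-- a primitive positive formula with free variables V:
-- ∃ y₁ … y_k . (conjunction of atomic formulas)
PP : Set → Set
PP V = Σ[ k ∈ ℕ ] List (Atom (V ⊎ Fin k))

module _ {L : Set} (R : Rel3 L) (a b : L) where

  evalTerm : {V : Set} → (V → L) → Term V → L
  evalTerm ρ (var v) = ρ v
  evalTerm ρ cstA    = a
  evalTerm ρ cstB    = b

  evalAtom : {V : Set} → (V → L) → Atom V → Set
  evalAtom ρ (eq s t)    = evalTerm ρ s ≡ evalTerm ρ t
  evalAtom ρ (rel s t u) = R (evalTerm ρ s) (evalTerm ρ t) (evalTerm ρ u)

  [_] : {A B : Set} {X : Set} → (A → X) → (B → X) → A ⊎ B → X
  [ f ] g (inj₁ x) = f x
  [ f ] g (inj₂ y) = g y

  ⟦_⟧ : {V : Set} → PP V → (V → L) → Set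
  ⟦ (k , atoms) ⟧ ρ = Σ[ w ∈ (Fin k → L) ] All (evalAtom ([ ρ ] w)) atoms

-- The structure ({0,1} ; NAE), with 0 = false, 1 = true

NAE : Bool → Bool → Bool → Set
NAE x y z = ¬ ((x , y , z) ≡ (false , false , false)) ×
            ¬ ((x , y , z) ≡ (true , true , true))

tuple3 : {X : Set} → X → X → X → Fin 3 → X
tuple3 x y z zero             = x
tuple3 x y z (suc zero)       = y
tuple3 x y z (suc (suc zero)) = z

tuple2 : {X : Set} → X → X → Fin 2 → X
tuple2 x y zero       = x
tuple2 x y (suc zero) = y

record PPInterpretsNAE {L : Set} (R : Rel3 L) (a b : L) : Set₁ where
  field
    d      : ℕ
    δ      : PP (Fin d)
    naeI   : PP (Fin 3 × Fin d)
    eqI    : PP (Fin 2 × Fin d)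
  Dom : Set
  Dom = Σ[ x ∈ (Fin d → L) ] ⟦ R ⟧ a b δ x
  field
    h          : Dom → Bool
    surjective : ∀ (v : Bool) → Σ[ u ∈ Dom ] h u ≡ v
    naeCorrect : ∀ (u₁ u₂ u₃ : Dom) →
      NAE (h u₁) (h u₂) (h u₃) ⇔
      ⟦ R ⟧ a b naeI (λ { (i , j) → proj₁ (tuple3 u₁ u₂ u₃ i) j })
    eqCorrect  : ∀ (u₁ u₂ : Dom) →
      (h u₁ ≡ h u₂) ⇔
      ⟦ R ⟧ a b eqI (λ { (i , j) → proj₁ (tuple2 u₁ u₂ i) j })

-- Label a point x with N(a, x, b) by the side of the pair a, b it lies on (b|ax or a|xb).
-- NAE(x, y, z) is expressed by ∃ v w. N(v,z,w) ∧ N(v,w,y) ∧ N(w,a,x) ∧ N(w,b,x) ∧ N(w,v,x), and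
-- equality of labels by a common z with NAE(x₁, z, z) ∧ NAE(x₂, z, z).  Every finite configuration of 𝕃
-- lies in an embedded finite binary tree, where C is read off the depths of youngest common ancestors,
-- an ultrametric.  There the formula fails when x, y, z lie on the same side: it would force three
-- leaves at pairwise equal meet depth, impossible in a binary tree.  For a nonconstant triple the
-- witnesses are x, y themselves, or z together with a new sibling of z, which exists in 𝕃 by homogeneity.
module Submission where

open import Defs
open import Data.Bool using (Bool; true; false; not)
open import Data.Empty using (⊥; ⊥-elim)
open import Data.Fin using (Fin; zero; suc; #_)
open import Data.Fin.Properties using (1↔⊤; +↔⊎; any?)
open import Data.List using (List; []; _∷_; _++_)
open import Data.List.Relation.Unary.All using (All; []; _∷_)
open import Data.List.Relation.Unary.All.Properties using (++⁺; ++⁻)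
open import Data.Nat using (ℕ; zero; suc; _+_; _≤_; _<_; z≤n; s≤s) renaming (_≟_ to _≟ℕ_)
open import Data.Nat.Properties
  using (module ≤-Reasoning; ≤-trans; ≤-reflexive; ≤-antisym; <⇒≤; <-irrefl; ≤-<-trans; <-≤-trans; <⇒≱; suc-injective)
open import Data.Product using (Σ-syntax; ∃₂; _×_; _,_; proj₁; proj₂)
open import Data.Sum using (_⊎_; inj₁; inj₂; [_,_]′) renaming (map to ⊎-map; swap to ⊎-swap)
open import Data.Sum.Function.Propositional using (_⊎-↔_)
open import Data.Sum.Properties using (inj₁-injective; inj₂-injective)
open import Data.Unit using (tt)
open import Data.Vec using (Vec; []; _∷_; lookup)
open import Function.Base using (_∘_)
open import Function.Bundles using (_⇔_; _↔_; mk⇔; Equivalence; Inverse; Injection)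
open import Function.Definitions using (Injective)
open import Function.Properties.Equivalence using () renaming (refl to ⇔-refl; sym to ⇔-sym; trans to ⇔-trans)
open import Function.Properties.Inverse using (↔-sym; ↔-trans; ↔⇒↣)
open import Relation.Binary.Definitions using (DecidableEquality)
open import Relation.Binary.PropositionalEquality using (_≡_; _≢_; refl; sym; trans; cong; subst)
open import Relation.Nullary.Decidable using (via-injection; yes; no)
open import Relation.Nullary.Negation using (¬_)

open Equivalence using (to; from)

meetDepth : (T : Tree) → Leaf T → Leaf T → ℕ
meetDepth leaf       _        _        = 0
meetDepth (node l r) (inj₁ x) (inj₁ y) = suc (meetDepth l x y)
meetDepth (node l r) (inj₁ x) (inj₂ y) = 0
meetDepth (node l r) (inj₂ x) (inj₁ y) = 0
meetDepth (node l r) (inj₂ x) (inj₂ y) = suc (meetDepth r x y)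

CT⇒meetDepth< : (T : Tree) (x y z : Leaf T) → CT T x y z → meetDepth T x y < meetDepth T y z
CT⇒meetDepth< (node l r) (inj₁ x) (inj₁ y) (inj₁ z) c  = s≤s (CT⇒meetDepth< l x y z c)
CT⇒meetDepth< (node l r) (inj₁ x) (inj₂ y) (inj₂ z) _  = s≤s z≤n
CT⇒meetDepth< (node l r) (inj₂ x) (inj₁ y) (inj₁ z) _  = s≤s z≤n
CT⇒meetDepth< (node l r) (inj₂ x) (inj₂ y) (inj₂ z) c  = s≤s (CT⇒meetDepth< r x y z c)

meetDepth<⇒CT : (T : Tree) (x y z : Leaf T) → meetDepth T x y < meetDepth T y z → CT T x y z
meetDepth<⇒CT (node l r) (inj₁ x) (inj₁ y) (inj₁ z) (s≤s c) = meetDepth<⇒CT l x y z c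
meetDepth<⇒CT (node l r) (inj₁ x) (inj₂ y) (inj₂ z) _       = tt
meetDepth<⇒CT (node l r) (inj₂ x) (inj₁ y) (inj₁ z) _       = tt
meetDepth<⇒CT (node l r) (inj₂ x) (inj₂ y) (inj₂ z) (s≤s c) = meetDepth<⇒CT r x y z c

meetDepth-sym : (T : Tree) (x y : Leaf T) → meetDepth T x y ≡ meetDepth T y x
meetDepth-sym leaf       _        _        = refl
meetDepth-sym (node l r) (inj₁ x) (inj₁ y) = cong suc (meetDepth-sym l x y)
meetDepth-sym (node l r) (inj₁ x) (inj₂ y) = refl
meetDepth-sym (node l r) (inj₂ x) (inj₁ y) = refl
meetDepth-sym (node l r) (inj₂ x) (inj₂ y) = cong suc (meetDepth-sym r x y)

meetDepth-ultra : (T : Tree) (x y z : Leaf T) →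
                  meetDepth T x y ≤ meetDepth T x z ⊎ meetDepth T y z ≤ meetDepth T x z
meetDepth-ultra leaf       _        _        _        = inj₁ z≤n
meetDepth-ultra (node l r) (inj₁ x) (inj₁ y) (inj₁ z) = ⊎-map s≤s s≤s (meetDepth-ultra l x y z)
meetDepth-ultra (node l r) (inj₁ x) (inj₁ y) (inj₂ z) = inj₂ z≤n
meetDepth-ultra (node l r) (inj₁ x) (inj₂ y) _        = inj₁ z≤n
meetDepth-ultra (node l r) (inj₂ x) (inj₁ y) _        = inj₁ z≤n
meetDepth-ultra (node l r) (inj₂ x) (inj₂ y) (inj₁ z) = inj₂ z≤n
meetDepth-ultra (node l r) (inj₂ x) (inj₂ y) (inj₂ z) = ⊎-map s≤s s≤s (meetDepth-ultra r x y z)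

meetDepth-binary : (T : Tree) (x y z : Leaf T) →
                   meetDepth T x y ≡ meetDepth T y z → meetDepth T y z ≡ meetDepth T x z → x ≡ y
meetDepth-binary leaf       _        _        _        _ _ = refl
meetDepth-binary (node l r) (inj₁ x) (inj₁ y) (inj₁ z) p q =
  cong inj₁ (meetDepth-binary l x y z (suc-injective p) (suc-injective q))
meetDepth-binary (node l r) (inj₂ x) (inj₂ y) (inj₂ z) p q =
  cong inj₂ (meetDepth-binary r x y z (suc-injective p) (suc-injective q))
meetDepth-binary (node l r) (inj₁ x) (inj₁ y) (inj₂ z) () _
meetDepth-binary (node l r) (inj₁ x) (inj₂ y) (inj₁ z) _ ()
meetDepth-binary (node l r) (inj₁ x) (inj₂ y) (inj₂ z) () _
meetDepth-binary (node l r) (inj₂ x) (inj₁ y) (inj₁ z) () _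
meetDepth-binary (node l r) (inj₂ x) (inj₁ y) (inj₂ z) _ ()
meetDepth-binary (node l r) (inj₂ x) (inj₂ y) (inj₁ z) () _

meetDepth<self : (T : Tree) (x y : Leaf T) → x ≡ y ⊎ meetDepth T x y < meetDepth T y y
meetDepth<self leaf       _        _        = inj₁ refl
meetDepth<self (node l r) (inj₁ x) (inj₁ y) = ⊎-map (cong inj₁) s≤s (meetDepth<self l x y)
meetDepth<self (node l r) (inj₁ x) (inj₂ y) = inj₂ (s≤s z≤n)
meetDepth<self (node l r) (inj₂ x) (inj₁ y) = inj₂ (s≤s z≤n)
meetDepth<self (node l r) (inj₂ x) (inj₂ y) = ⊎-map (cong inj₂) s≤s (meetDepth<self r x y)

CT-swap : (T : Tree) (x y z : Leaf T) → CT T x y z → CT T x z y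
CT-swap (node l r) (inj₁ x) (inj₁ y) (inj₁ z) c = CT-swap l x y z c
CT-swap (node l r) (inj₁ x) (inj₂ y) (inj₂ z) c = tt
CT-swap (node l r) (inj₂ x) (inj₁ y) (inj₁ z) c = tt
CT-swap (node l r) (inj₂ x) (inj₂ y) (inj₂ z) c = CT-swap r x y z c

sprout : (T : Tree) → Leaf T → Tree
sprout leaf       _        = node leaf leaf
sprout (node l r) (inj₁ ℓ) = node (sprout l ℓ) r
sprout (node l r) (inj₂ ℓ) = node l (sprout r ℓ)

oldLeaf : (T : Tree) (ℓ : Leaf T) → Leaf T → Leaf (sprout T ℓ)
oldLeaf leaf       _        _        = inj₁ tt
oldLeaf (node l r) (inj₁ ℓ) (inj₁ x) = inj₁ (oldLeaf l ℓ x)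
oldLeaf (node l r) (inj₁ ℓ) (inj₂ x) = inj₂ x
oldLeaf (node l r) (inj₂ ℓ) (inj₁ x) = inj₁ x
oldLeaf (node l r) (inj₂ ℓ) (inj₂ x) = inj₂ (oldLeaf r ℓ x)

newLeaf : (T : Tree) (ℓ : Leaf T) → Leaf (sprout T ℓ)
newLeaf leaf       _        = inj₂ tt
newLeaf (node l r) (inj₁ ℓ) = inj₁ (newLeaf l ℓ)
newLeaf (node l r) (inj₂ ℓ) = inj₂ (newLeaf r ℓ)

oldLeaf-injective : (T : Tree) (ℓ : Leaf T) {x y : Leaf T} → oldLeaf T ℓ x ≡ oldLeaf T ℓ y → x ≡ y
oldLeaf-injective leaf       _        {tt}     {tt}     _ = refl
oldLeaf-injective (node l r) (inj₁ ℓ) {inj₁ x} {inj₁ y} e = cong inj₁ (oldLeaf-injective l ℓ (inj₁-injective e))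
oldLeaf-injective (node l r) (inj₁ ℓ) {inj₂ x} {inj₂ y} e = cong inj₂ (inj₂-injective e)
oldLeaf-injective (node l r) (inj₂ ℓ) {inj₁ x} {inj₁ y} e = cong inj₁ (inj₁-injective e)
oldLeaf-injective (node l r) (inj₂ ℓ) {inj₂ x} {inj₂ y} e = cong inj₂ (oldLeaf-injective r ℓ (inj₂-injective e))

CT-oldLeaf : (T : Tree) (ℓ x y z : Leaf T) →
             CT (sprout T ℓ) (oldLeaf T ℓ x) (oldLeaf T ℓ y) (oldLeaf T ℓ z) ⇔ CT T x y z
CT-oldLeaf leaf       _        _        _        _        = ⇔-refl
CT-oldLeaf (node l r) (inj₁ ℓ) (inj₁ x) (inj₁ y) (inj₁ z) = CT-oldLeaf l ℓ x y z
CT-oldLeaf (node l r) (inj₁ ℓ) (inj₁ x) (inj₁ y) (inj₂ z) = ⇔-refl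
CT-oldLeaf (node l r) (inj₁ ℓ) (inj₁ x) (inj₂ y) (inj₁ z) = ⇔-refl
CT-oldLeaf (node l r) (inj₁ ℓ) (inj₁ x) (inj₂ y) (inj₂ z) = ⇔-refl
CT-oldLeaf (node l r) (inj₁ ℓ) (inj₂ x) (inj₁ y) (inj₁ z) = ⇔-refl
CT-oldLeaf (node l r) (inj₁ ℓ) (inj₂ x) (inj₁ y) (inj₂ z) = ⇔-refl
CT-oldLeaf (node l r) (inj₁ ℓ) (inj₂ x) (inj₂ y) (inj₁ z) = ⇔-refl
CT-oldLeaf (node l r) (inj₁ ℓ) (inj₂ x) (inj₂ y) (inj₂ z) = ⇔-refl
CT-oldLeaf (node l r) (inj₂ ℓ) (inj₁ x) (inj₁ y) (inj₁ z) = ⇔-refl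
CT-oldLeaf (node l r) (inj₂ ℓ) (inj₁ x) (inj₁ y) (inj₂ z) = ⇔-refl
CT-oldLeaf (node l r) (inj₂ ℓ) (inj₁ x) (inj₂ y) (inj₁ z) = ⇔-refl
CT-oldLeaf (node l r) (inj₂ ℓ) (inj₁ x) (inj₂ y) (inj₂ z) = ⇔-refl
CT-oldLeaf (node l r) (inj₂ ℓ) (inj₂ x) (inj₁ y) (inj₁ z) = ⇔-refl
CT-oldLeaf (node l r) (inj₂ ℓ) (inj₂ x) (inj₁ y) (inj₂ z) = ⇔-refl
CT-oldLeaf (node l r) (inj₂ ℓ) (inj₂ x) (inj₂ y) (inj₁ z) = ⇔-refl
CT-oldLeaf (node l r) (inj₂ ℓ) (inj₂ x) (inj₂ y) (inj₂ z) = CT-oldLeaf r ℓ x y z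

newLeaf-nearest : (T : Tree) (ℓ s : Leaf T) →
  s ≡ ℓ ⊎ meetDepth (sprout T ℓ) (oldLeaf T ℓ ℓ) (oldLeaf T ℓ s) < meetDepth (sprout T ℓ) (newLeaf T ℓ) (oldLeaf T ℓ ℓ)
newLeaf-nearest leaf       _        _        = inj₁ refl
newLeaf-nearest (node l r) (inj₁ ℓ) (inj₁ s) = ⊎-map (cong inj₁) s≤s (newLeaf-nearest l ℓ s)
newLeaf-nearest (node l r) (inj₁ ℓ) (inj₂ s) = inj₂ (s≤s z≤n)
newLeaf-nearest (node l r) (inj₂ ℓ) (inj₁ s) = inj₂ (s≤s z≤n)
newLeaf-nearest (node l r) (inj₂ ℓ) (inj₂ s) = ⊎-map (cong inj₂) s≤s (newLeaf-nearest r ℓ s)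

newLeaf-distinct : (T : Tree) (ℓ : Leaf T) →
  meetDepth (sprout T ℓ) (newLeaf T ℓ) (oldLeaf T ℓ ℓ) < meetDepth (sprout T ℓ) (oldLeaf T ℓ ℓ) (oldLeaf T ℓ ℓ)
newLeaf-distinct leaf       _        = s≤s z≤n
newLeaf-distinct (node l r) (inj₁ ℓ) = s≤s (newLeaf-distinct l ℓ)
newLeaf-distinct (node l r) (inj₂ ℓ) = s≤s (newLeaf-distinct r ℓ)

Gadget : {X : Set} → Rel3 X → X → X → X → X → X → X → X → Set
Gadget R a b x y z v w = R v z w × R v w y × R w a x × R w b x × R w v x

Gadget-swap : {X : Set} (R : Rel3 X) {a b x y z v w : X} → Gadget R b a x y z v w → Gadget R a b x y z v w
Gadget-swap _ (vzw , vwy , wbx , wax , wvx) = vzw , vwy , wax , wbx , wvx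

Gadget-map : {I X Y : Set} (R : Rel3 X) (S : Rel3 Y) (f : I → X) (g : I → Y) →
  (∀ i j k → R (f i) (f j) (f k) → S (g i) (g j) (g k)) → ∀ ia ib ix iy iz iv iw →
  Gadget R (f ia) (f ib) (f ix) (f iy) (f iz) (f iv) (f iw) → Gadget S (g ia) (g ib) (g ix) (g iy) (g iz) (g iv) (g iw)
Gadget-map _ _ _ _ R⇒S ia ib ix iy iz iv iw (vzw , vwy , wax , wbx , wvx) =
  R⇒S iv iz iw vzw , R⇒S iv iw iy vwy , R⇒S iw ia ix wax , R⇒S iw ib ix wbx , R⇒S iw iv ix wvx

module Geometry (T : Tree) where

  private
    μ : Leaf T → Leaf T → ℕ
    μ = meetDepth T

    μ-sym : ∀ x y → μ x y ≡ μ y x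
    μ-sym = meetDepth-sym T

  isosceles : ∀ x y z → μ x y < μ y z → μ x z ≡ μ x y
  isosceles x y z xy<yz = ≤-antisym xz≤xy xy≤xz
    where
    xz≤xy : μ x z ≤ μ x y
    xz≤xy = [ (λ le → le) , (λ zy≤xy → ⊥-elim (<⇒≱ xy<yz (≤-trans (≤-reflexive (μ-sym y z)) zy≤xy))) ]′
              (meetDepth-ultra T x z y)
    xy≤xz : μ x y ≤ μ x z
    xy≤xz = [ (λ le → le) , (λ yz≤xz → <⇒≤ (<-≤-trans xy<yz yz≤xz)) ]′ (meetDepth-ultra T x y z)

  N⇒meetDepth≤ : ∀ p q r → N (CT T) p q r → μ p r ≤ μ p q × μ p r ≤ μ q r
  N⇒meetDepth≤ p q r (inj₁ rp|q) = pr≤pq , ≤-reflexive (trans (μ-sym p r) (trans (sym rq≡rp) (μ-sym r q)))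
    where
    rp<pq : μ r p < μ p q
    rp<pq = CT⇒meetDepth< T r p q rp|q
    rq≡rp : μ r q ≡ μ r p
    rq≡rp = isosceles r p q rp<pq
    pr≤pq : μ p r ≤ μ p q
    pr≤pq = <⇒≤ (≤-<-trans (≤-reflexive (μ-sym p r)) rp<pq)
  N⇒meetDepth≤ p q r (inj₂ p|qr) = ≤-reflexive pr≡pq , <⇒≤ (≤-<-trans (≤-reflexive pr≡pq) pq<qr)
    where
    pq<qr : μ p q < μ q r
    pq<qr = CT⇒meetDepth< T p q r p|qr
    pr≡pq : μ p r ≡ μ p q
    pr≡pq = isosceles p q r pq<qr

  -- t lies below the meet of P and Q, on the branch of P
  Side : Leaf T → Leaf T → Leaf T → Set
  Side P Q t = μ P Q < μ P t

  CT⇒Side : ∀ P Q t → CT T Q P t → Side P Q t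
  CT⇒Side P Q t Q|Pt = ≤-<-trans (≤-reflexive (μ-sym P Q)) (CT⇒meetDepth< T Q P t Q|Pt)

  Side⇒meetDepth≡ : ∀ {P Q t} → Side P Q t → μ Q t ≡ μ P Q
  Side⇒meetDepth≡ {P} {Q} {t} side = trans (isosceles Q P t (≤-<-trans (≤-reflexive (μ-sym Q P)) side)) (μ-sym Q P)

  Side-meet : ∀ {P Q x y} → Side P Q x → Side P Q y → μ P Q < μ x y
  Side-meet {P} {Q} {x} {y} sx sy =
    [ (λ xP≤xy → <-≤-trans sx (≤-trans (≤-reflexive (μ-sym P x)) xP≤xy)) , (λ Py≤xy → <-≤-trans sy Py≤xy) ]′
      (meetDepth-ultra T x P y)

  Side-opposite : ∀ {P Q x y} → Side P Q x → Side Q P y → μ x y ≡ μ P Q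
  Side-opposite {P} {Q} {x} {y} sx sy = trans (μ-sym x y) (trans (isosceles y P x yP<Px) yP≡PQ)
    where
    yP≡PQ : μ y P ≡ μ P Q
    yP≡PQ = trans (μ-sym y P) (trans (Side⇒meetDepth≡ sy) (μ-sym Q P))
    yP<Px : μ y P < μ P x
    yP<Px = ≤-<-trans (≤-reflexive yP≡PQ) sx

  Side-gadget-absurd : ∀ {P Q X Y Z V W} → Side P Q X → Side P Q Y → Side P Q Z →
    N (CT T) V Z W → N (CT T) V W Y → N (CT T) W Q X → N (CT T) W V X → ⊥
  Side-gadget-absurd {P} {Q} {X} {Y} {Z} {V} {W} sX sY sZ vzw vwy wqx wvx =
    <-irrefl (trans (cong (λ w → μ w X) W≡Y) (μ-sym Y X)) WX<XY
    where
    WX≤PQ : μ W X ≤ μ P Q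
    WX≤PQ = ≤-trans (proj₂ (N⇒meetDepth≤ W Q X wqx)) (≤-reflexive (Side⇒meetDepth≡ sX))
    WX<XY : μ W X < μ X Y
    WX<XY = ≤-<-trans WX≤PQ (Side-meet sX sY)
    WY≡WX : μ W Y ≡ μ W X
    WY≡WX = isosceles W X Y WX<XY
    WZ≡WX : μ W Z ≡ μ W X
    WZ≡WX = isosceles W X Z (≤-<-trans WX≤PQ (Side-meet sX sZ))
    VW≤WX : μ V W ≤ μ W X
    VW≤WX = ≤-trans (proj₂ (N⇒meetDepth≤ V Z W vzw)) (≤-reflexive (trans (μ-sym Z W) WZ≡WX))
    WX≤VY : μ W X ≤ μ V Y
    WX≤VY = [ (λ VX≤VY → ≤-trans (proj₂ (N⇒meetDepth≤ W V X wvx)) VX≤VY) , (λ XY≤VY → <⇒≤ (<-≤-trans WX<XY XY≤VY)) ]′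
              (meetDepth-ultra T V X Y)
    VY≤VW : μ V Y ≤ μ V W
    VY≤VW = proj₁ (N⇒meetDepth≤ V W Y vwy)
    VY≡WX : μ V Y ≡ μ W X
    VY≡WX = ≤-antisym (≤-trans VY≤VW VW≤WX) WX≤VY
    VW≡WX : μ V W ≡ μ W X
    VW≡WX = ≤-antisym VW≤WX (≤-trans WX≤VY VY≤VW)
    -- V, W and Y are pairwise at meet depth μ W X, which binary branching allows only if two coincide.
    W≡Y : W ≡ Y
    W≡Y = meetDepth-binary T W Y V (trans WY≡WX (sym (trans (μ-sym Y V) VY≡WX)))
                                   (trans (trans (μ-sym Y V) VY≡WX) (sym (trans (μ-sym W V) VW≡WX)))

  opposite-Sides⇒N : ∀ {P Q X Y} → Side P Q X → Side Q P Y → N (CT T) Y P X × N (CT T) Y Q X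
  opposite-Sides⇒N {P} {Q} {X} {Y} sX sY = inj₂ (meetDepth<⇒CT T Y P X YP<PX) , inj₁ (meetDepth<⇒CT T X Y Q XY<YQ)
    where
    open ≤-Reasoning
    YP<PX : μ Y P < μ P X
    YP<PX = begin-strict
      μ Y P ≡⟨ μ-sym Y P ⟩
      μ P Y ≡⟨ Side⇒meetDepth≡ sY ⟩
      μ Q P ≡⟨ μ-sym Q P ⟩
      μ P Q <⟨ sX ⟩
      μ P X ∎
    XY<YQ : μ X Y < μ Y Q
    XY<YQ = begin-strict
      μ X Y ≡⟨ Side-opposite sX sY ⟩
      μ P Q ≡⟨ μ-sym P Q ⟩
      μ Q P <⟨ sY ⟩
      μ Q Y ≡⟨ μ-sym Q Y ⟩
      μ Y Q ∎

  opposite-Sides⇒Gadget : ∀ {P Q X Y Z} → Side P Q X → Side Q P Y → Side P Q Z ⊎ Side Q P Z →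
                           Gadget (N (CT T)) P Q X Y Z X Y
  opposite-Sides⇒Gadget {P} {Q} {X} {Y} {Z} sX sY sZ = xzy sZ , xyy , proj₁ yN , proj₂ yN , yxx
    where
    open ≤-Reasoning
    yN : N (CT T) Y P X × N (CT T) Y Q X
    yN = opposite-Sides⇒N sX sY
    xzy : Side P Q Z ⊎ Side Q P Z → N (CT T) X Z Y
    xzy (inj₁ sZ) = inj₁ (meetDepth<⇒CT T Y X Z (begin-strict
      μ Y X ≡⟨ μ-sym Y X ⟩
      μ X Y ≡⟨ Side-opposite sX sY ⟩
      μ P Q <⟨ Side-meet sX sZ ⟩
      μ X Z ∎))
    xzy (inj₂ sZ) = inj₂ (meetDepth<⇒CT T X Z Y (begin-strict
      μ X Z ≡⟨ Side-opposite sX sZ ⟩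
      μ P Q ≡⟨ μ-sym P Q ⟩
      μ Q P <⟨ Side-meet sZ sY ⟩
      μ Z Y ∎))
    xyy : N (CT T) X Y Y
    xyy = inj₂ (meetDepth<⇒CT T X Y Y (begin-strict
      μ X Y ≡⟨ Side-opposite sX sY ⟩
      μ P Q ≡⟨ μ-sym P Q ⟩
      μ Q P <⟨ Side-meet sY sY ⟩
      μ Y Y ∎))
    yxx : N (CT T) Y X X
    yxx = inj₂ (meetDepth<⇒CT T Y X X (begin-strict
      μ Y X ≡⟨ μ-sym Y X ⟩
      μ X Y ≡⟨ Side-opposite sX sY ⟩
      μ P Q <⟨ Side-meet sX sX ⟩
      μ X X ∎))

  twin-Sides⇒Gadget : ∀ {P Q X Y Z U} → Side P Q X → Side P Q Y → Side Q P Z →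
                       P ≡ Z ⊎ μ Z P < μ U Z → μ U Z < μ Z Z → Gadget (N (CT T)) P Q X Y Z Z U
  twin-Sides⇒Gadget {P} {Q} {X} {Y} {Z} {U} sX sY sZ U-nearest U≢Z =
    inj₁ (meetDepth<⇒CT T U Z Z U≢Z) , zuy , proj₁ uN , proj₂ uN , uzx
    where
    open ≤-Reasoning
    ZP<UZ : μ Z P < μ U Z
    ZP<UZ = [ (λ { refl → ⊥-elim (<-irrefl refl sZ) }) , (λ lt → lt) ]′ U-nearest
    PQ<UZ : μ P Q < μ U Z
    PQ<UZ = begin-strict
      μ P Q ≡⟨ μ-sym P Q ⟩
      μ Q P ≡⟨ Side⇒meetDepth≡ sZ ⟨
      μ P Z ≡⟨ μ-sym P Z ⟩
      μ Z P <⟨ ZP<UZ ⟩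
      μ U Z ∎
    sU : Side Q P U
    sU = [ (λ QZ≤QU → <-≤-trans sZ QZ≤QU) ,
           (λ ZU≤QU → begin-strict μ Q P ≡⟨ μ-sym Q P ⟩ μ P Q <⟨ PQ<UZ ⟩ μ U Z ≡⟨ μ-sym U Z ⟩ μ Z U ≤⟨ ZU≤QU ⟩ μ Q U ∎) ]′
           (meetDepth-ultra T Q Z U)
    uN : N (CT T) U P X × N (CT T) U Q X
    uN = opposite-Sides⇒N sX sU
    zuy : N (CT T) Z U Y
    zuy = inj₁ (meetDepth<⇒CT T Y Z U (begin-strict
      μ Y Z ≡⟨ Side-opposite sY sZ ⟩
      μ P Q <⟨ PQ<UZ ⟩
      μ U Z ≡⟨ μ-sym U Z ⟩
      μ Z U ∎))
    uzx : N (CT T) U Z X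
    uzx = inj₁ (meetDepth<⇒CT T X U Z (begin-strict
      μ X U ≡⟨ Side-opposite sX sU ⟩
      μ P Q <⟨ PQ<UZ ⟩
      μ U Z ∎))

  module Poles (A B : Leaf T) where

    pole : Bool → Leaf T
    pole true  = A
    pole false = B

    SideOf : Bool → Leaf T → Set
    SideOf β = Side (pole β) (pole (not β))

    SideOf⇒Side⊎Side : ∀ β {Z} → SideOf β Z → Side A B Z ⊎ Side B A Z
    SideOf⇒Side⊎Side true  = inj₁
    SideOf⇒Side⊎Side false = inj₂

    SideOf-Gadget-absurd : ∀ β {X Y Z V W} → SideOf β X → SideOf β Y → SideOf β Z →
                           Gadget (N (CT T)) A B X Y Z V W → ⊥
    SideOf-Gadget-absurd true  sX sY sZ (vzw , vwy , _   , wbx , wvx) = Side-gadget-absurd sX sY sZ vzw vwy wbx wvx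
    SideOf-Gadget-absurd false sX sY sZ (vzw , vwy , wax , _   , wvx) = Side-gadget-absurd sX sY sZ vzw vwy wax wvx

    opposite-SideOf⇒Gadget : ∀ β γ {X Y Z} → SideOf β X → SideOf (not β) Y → SideOf γ Z →
                              Gadget (N (CT T)) A B X Y Z X Y
    opposite-SideOf⇒Gadget true  γ sX sY sZ = opposite-Sides⇒Gadget sX sY (SideOf⇒Side⊎Side γ sZ)
    opposite-SideOf⇒Gadget false γ sX sY sZ =
      Gadget-swap (N (CT T)) (opposite-Sides⇒Gadget sX sY (⊎-swap (SideOf⇒Side⊎Side γ sZ)))

    twin-SideOf⇒Gadget : ∀ β {X Y Z U} → SideOf β X → SideOf β Y → SideOf (not β) Z →
                          (∀ γ → pole γ ≡ Z ⊎ μ Z (pole γ) < μ U Z) → μ U Z < μ Z Z →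
                          Gadget (N (CT T)) A B X Y Z Z U
    twin-SideOf⇒Gadget true  sX sY sZ U-nearest U≢Z = twin-Sides⇒Gadget sX sY sZ (U-nearest true) U≢Z
    twin-SideOf⇒Gadget false sX sY sZ U-nearest U≢Z = Gadget-swap (N (CT T)) (twin-Sides⇒Gadget sX sY sZ (U-nearest false) U≢Z)

leafEnumeration : (T : Tree) → Σ[ m ∈ ℕ ] (Fin m ↔ Leaf T)
leafEnumeration leaf       = 1 , 1↔⊤
leafEnumeration (node l r) with leafEnumeration l | leafEnumeration r
... | m , G | n , H = m + n , ↔-trans +↔⊎ (G ⊎-↔ H)

Rel3-resp : {X : Set} (R : Rel3 X) {x x′ y y′ z z′ : X} → x ≡ x′ → y ≡ y′ → z ≡ z′ → R x y z ⇔ R x′ y′ z′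
Rel3-resp R refl refl refl = ⇔-refl

module HomogeneousC {L : Set} {C : Rel3 L} (H : IsHomBinBranchingC L C) where

  open IsHomBinBranchingC H

  _≟_ : DecidableEquality L
  _≟_ = via-injection (↔⇒↣ (↔-sym countablyInfinite)) _≟ℕ_

  side : ∀ {a x b} → N C a x b → Bool
  side (inj₁ _) = true
  side (inj₂ _) = false

  IsTreeEmbedding : (T : Tree) → (Leaf T → L) → Set
  IsTreeEmbedding T ε = ∀ x y z → CT T x y z ⇔ C (ε x) (ε y) (ε z)

  IsAutomorphism : L ↔ L → Set
  IsAutomorphism α = ∀ x y z → C x y z ⇔ C (Inverse.to α x) (Inverse.to α y) (Inverse.to α z)

  treeEmbeddings-conjugate : (T : Tree) (ε₁ ε₂ : Leaf T → L) →
    Injective _≡_ _≡_ ε₁ → Injective _≡_ _≡_ ε₂ → IsTreeEmbedding T ε₁ → IsTreeEmbedding T ε₂ →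
    Σ[ α ∈ L ↔ L ] IsAutomorphism α × (∀ x → Inverse.to α (ε₁ x) ≡ ε₂ x)
  treeEmbeddings-conjugate T ε₁ ε₂ ε₁-injective ε₂-injective ε₁-embedding ε₂-embedding =
    let α , α-automorphism , α-maps = homogeneous _ (ε₁ ∘ G.to) (ε₂ ∘ G.to)
                                        (G-injective ∘ ε₁-injective) (G-injective ∘ ε₂-injective) sameType
    in α , α-automorphism , λ x → subst (λ y → Inverse.to α (ε₁ y) ≡ ε₂ y) (G.strictlyInverseˡ x) (α-maps (G.from x))
    where
    G : Fin (proj₁ (leafEnumeration T)) ↔ Leaf T
    G = proj₂ (leafEnumeration T)
    module G = Inverse G
    G-injective : Injective _≡_ _≡_ G.to
    G-injective = Injection.injective (↔⇒↣ G)
    sameType : ∀ i j k → C (ε₁ (G.to i)) (ε₁ (G.to j)) (ε₁ (G.to k)) ⇔ C (ε₂ (G.to i)) (ε₂ (G.to j)) (ε₂ (G.to k))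
    sameType i j k = ⇔-trans (⇔-sym (ε₁-embedding _ _ _)) (ε₂-embedding _ _ _)

  record ImageEnumeration {n : ℕ} (f : Fin (suc n) → L) : Set where
    field
      k              : ℕ
      enum           : Fin (suc k) → L
      enum-injective : Injective _≡_ _≡_ enum
      index          : Fin (suc n) → Fin (suc k)
      enum-index     : ∀ i → enum (index i) ≡ f i

  imageEnumeration : ∀ n (f : Fin (suc n) → L) → ImageEnumeration f
  imageEnumeration zero    f = record
    { k = 0 ; enum = f ; enum-injective = λ { {zero} {zero} _ → refl } ; index = λ i → i ; enum-index = λ _ → refl }
  imageEnumeration (suc n) f with imageEnumeration n (f ∘ suc)
  ... | E with any? (λ j → ImageEnumeration.enum E j ≟ f zero)
  ...   | yes (j , enum-j≡f0) = record
    { k = k ; enum = enum ; enum-injective = enum-injective ; index = index′ ; enum-index = enum-index′ }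
    where
    open ImageEnumeration E
    index′ : Fin (suc (suc n)) → Fin (suc k)
    index′ zero    = j
    index′ (suc i) = index i
    enum-index′ : ∀ i → enum (index′ i) ≡ f i
    enum-index′ zero    = enum-j≡f0
    enum-index′ (suc i) = enum-index i
  ...   | no f0∉image = record
    { k = suc k ; enum = enum′ ; enum-injective = enum′-injective ; index = index′ ; enum-index = enum-index′ }
    where
    open ImageEnumeration E
    enum′ : Fin (suc (suc k)) → L
    enum′ zero    = f zero
    enum′ (suc j) = enum j
    enum′-injective : Injective _≡_ _≡_ enum′
    enum′-injective {zero}  {zero}  _ = refl
    enum′-injective {zero}  {suc j} e = ⊥-elim (f0∉image (j , sym e))
    enum′-injective {suc i} {zero}  e = ⊥-elim (f0∉image (i , e))
    enum′-injective {suc i} {suc j} e = cong suc (enum-injective e)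
    index′ : Fin (suc (suc n)) → Fin (suc (suc k))
    index′ zero    = zero
    index′ (suc i) = suc (index i)
    enum-index′ : ∀ i → enum′ (index′ i) ≡ f i
    enum-index′ zero    = refl
    enum-index′ (suc i) = enum-index i

  record TreeModel {n : ℕ} (xs : Vec L n) : Set where
    f : Fin n → L
    f = lookup xs
    field
      tree                : Tree
      embedding           : Leaf tree → L
      embedding-injective : Injective _≡_ _≡_ embedding
      isTreeEmbedding     : IsTreeEmbedding tree embedding
      place               : Fin n → Leaf tree
      embedding-place     : ∀ i → embedding (place i) ≡ f i

    C⇔CT : ∀ i j k → C (f i) (f j) (f k) ⇔ CT tree (place i) (place j) (place k)
    C⇔CT i j k = ⇔-trans (Rel3-resp C (sym (embedding-place i)) (sym (embedding-place j)) (sym (embedding-place k)))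
                         (⇔-sym (isTreeEmbedding _ _ _))

    N⇒N-tree : ∀ i j k → N C (f i) (f j) (f k) → N (CT tree) (place i) (place j) (place k)
    N⇒N-tree i j k = ⊎-map (to (C⇔CT k i j)) (to (C⇔CT i j k))

    N-tree⇒N : ∀ i j k → N (CT tree) (place i) (place j) (place k) → N C (f i) (f j) (f k)
    N-tree⇒N i j k = ⊎-map (from (C⇔CT k i j)) (from (C⇔CT i j k))

    place-reflects-≡ : ∀ {i j} → place i ≡ place j → f i ≡ f j
    place-reflects-≡ {i} {j} e = trans (sym (embedding-place i)) (trans (cong embedding e) (embedding-place j))

    N⇒SideOf : ∀ ia ib ix (p : N C (f ia) (f ix) (f ib)) →
               Geometry.Poles.SideOf tree (place ia) (place ib) (side p) (place ix)
    N⇒SideOf ia ib ix (inj₁ b|ax) = Geometry.CT⇒Side tree _ _ _ (to (C⇔CT ib ia ix) b|ax)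
    N⇒SideOf ia ib ix (inj₂ a|xb) = Geometry.CT⇒Side tree _ _ _ (CT-swap tree _ _ _ (to (C⇔CT ia ix ib) a|xb))

  treeModel : ∀ n (xs : Vec L (suc n)) → TreeModel xs
  treeModel n xs with imageEnumeration n (lookup xs)
  ... | E with ageInTrees (ImageEnumeration.k E) (ImageEnumeration.enum E) (ImageEnumeration.enum-injective E)
  ...   | T , G , enum⇔CT = record
    { tree                = T
    ; embedding           = enum ∘ G.from
    ; embedding-injective = Injection.injective (↔⇒↣ (↔-sym G)) ∘ enum-injective
    ; isTreeEmbedding     = enum∘from-isTreeEmbedding
    ; place               = G.to ∘ index
    ; embedding-place     = λ i → trans (cong enum (G.strictlyInverseʳ (index i))) (enum-index i)
    }
    where
    open ImageEnumeration E
    module G = Inverse G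
    enum∘from-isTreeEmbedding : IsTreeEmbedding T (enum ∘ G.from)
    enum∘from-isTreeEmbedding x y z =
      ⇔-sym (⇔-trans (enum⇔CT _ _ _) (Rel3-resp (CT T) (G.strictlyInverseˡ x) (G.strictlyInverseˡ y) (G.strictlyInverseˡ z)))

  record TwinModel {n : ℕ} (xs : Vec L n) (t : Fin n) : Set where
    field
      twin  : L
      model : TreeModel (twin ∷ xs)
    open TreeModel model
    field
      twin-nearest  : ∀ i → place (suc i) ≡ place (suc t) ⊎
                            meetDepth tree (place (suc t)) (place (suc i)) < meetDepth tree (place zero) (place (suc t))
      twin-distinct : meetDepth tree (place zero) (place (suc t)) < meetDepth tree (place (suc t)) (place (suc t))

  -- Realise the tree with a leaf sprouted next to the leaf of t, then move its old leaves onto M by an automorphism.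
  module _ {n} {xs : Vec L n} (M : TreeModel xs) (t : Fin n) where

    open TreeModel M

    private
      ℓ : Leaf tree
      ℓ = place t

      restrict-isTreeEmbedding : (ε : Leaf (sprout tree ℓ) → L) →
                                 IsTreeEmbedding (sprout tree ℓ) ε → IsTreeEmbedding tree (ε ∘ oldLeaf tree ℓ)
      restrict-isTreeEmbedding ε ε-embedding x y z = ⇔-trans (⇔-sym (CT-oldLeaf tree ℓ x y z)) (ε-embedding _ _ _)

    twinModel : TwinModel xs t
    twinModel with treesInAge (sprout tree ℓ)
    ... | ε , ε-injective , ε-embedding
        with treeEmbeddings-conjugate tree (ε ∘ oldLeaf tree ℓ) embedding (oldLeaf-injective tree ℓ ∘ ε-injective)
               embedding-injective (restrict-isTreeEmbedding ε ε-embedding) isTreeEmbedding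
    ... | α , α-automorphism , α-maps = record
      { twin          = Inverse.to α (ε (newLeaf tree ℓ))
      ; model         = record
        { tree                = sprout tree ℓ
        ; embedding           = Inverse.to α ∘ ε
        ; embedding-injective = ε-injective ∘ Injection.injective (↔⇒↣ α)
        ; isTreeEmbedding     = λ x y z → ⇔-trans (ε-embedding x y z) (α-automorphism _ _ _)
        ; place               = λ { zero → newLeaf tree ℓ ; (suc i) → oldLeaf tree ℓ (place i) }
        ; embedding-place     = λ { zero → refl ; (suc i) → trans (α-maps (place i)) (embedding-place i) }
        }
      ; twin-nearest  = λ i → ⊎-map (cong (oldLeaf tree ℓ)) (λ lt → lt) (newLeaf-nearest tree ℓ (place i))
      ; twin-distinct = newLeaf-distinct tree ℓ
      }

  C-distinct : ∀ {x y} → x ≢ y → C y x x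
  C-distinct {x} {y} x≢y =
    [ (λ e → ⊥-elim (x≢y (sym (place-reflects-≡ e)))) , (λ lt → from (C⇔CT (# 1) (# 0) (# 0)) (meetDepth<⇒CT tree _ _ _ lt)) ]′
      (meetDepth<self tree (place (# 1)) (place (# 0)))
    where open TreeModel (treeModel 1 (x ∷ y ∷ []))

NAE-cases : ∀ {p q r} → NAE p q r → q ≡ not p ⊎ (q ≡ p × r ≡ not p)
NAE-cases {false} {false} {false} (≢000 , _) = ⊥-elim (≢000 refl)
NAE-cases {false} {false} {true}  _          = inj₂ (refl , refl)
NAE-cases {false} {true}          _          = inj₁ refl
NAE-cases {true}  {false}         _          = inj₁ refl
NAE-cases {true}  {true}  {false} _          = inj₂ (refl , refl)
NAE-cases {true}  {true}  {true}  (_ , ≢111) = ⊥-elim (≢111 refl)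

nonconstant⇒NAE : ∀ {p q r} → ¬ (p ≡ q × q ≡ r) → NAE p q r
nonconstant⇒NAE nonconstant = (λ { refl → nonconstant (refl , refl) }) , (λ { refl → nonconstant (refl , refl) })

NAE-pqq⇔≡not : ∀ {p q} → NAE p q q ⇔ p ≡ not q
NAE-pqq⇔≡not = mk⇔ to′ from′
  where
  to′ : ∀ {p q} → NAE p q q → p ≡ not q
  to′ {false} {false} (≢000 , _) = ⊥-elim (≢000 refl)
  to′ {false} {true}  _          = refl
  to′ {true}  {false} _          = refl
  to′ {true}  {true}  (_ , ≢111) = ⊥-elim (≢111 refl)
  from′ : ∀ {p q} → p ≡ not q → NAE p q q
  from′ {q = false} refl = (λ ()) , (λ ())
  from′ {q = true}  refl = (λ ()) , (λ ())

module Interpretation {L : Set} {C : Rel3 L} (H : IsHomBinBranchingC L C) (a b : L) (a≢b : a ≢ b) where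

  open HomogeneousC H

  Gadget⇒NAE : ∀ {x y z v w} (px : N C a x b) (py : N C a y b) (pz : N C a z b) →
               Gadget (N C) a b x y z v w → NAE (side px) (side py) (side pz)
  Gadget⇒NAE {x} {y} {z} {v} {w} px py pz gadget = nonconstant⇒NAE λ (x~y , y~z) →
    SideOf-Gadget-absurd (side px) (N⇒SideOf (# 3) (# 4) (# 0) px)
      (subst (λ β → SideOf β (place (# 1))) (sym x~y) (N⇒SideOf (# 3) (# 4) (# 1) py))
      (subst (λ β → SideOf β (place (# 2))) (sym (trans x~y y~z)) (N⇒SideOf (# 3) (# 4) (# 2) pz))
      (Gadget-map (N C) (N (CT tree)) _ place N⇒N-tree (# 3) (# 4) (# 0) (# 1) (# 2) (# 5) (# 6) gadget)
    where
    open TreeModel (treeModel 6 (x ∷ y ∷ z ∷ a ∷ b ∷ v ∷ w ∷ []))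
    open Geometry.Poles tree (place (# 3)) (place (# 4))

  separated⇒Gadget : ∀ {x y z} (px : N C a x b) (py : N C a y b) (pz : N C a z b) →
                          side py ≡ not (side px) → Gadget (N C) a b x y z x y
  separated⇒Gadget {x} {y} {z} px py pz y-opposite =
    Gadget-map (N (CT tree)) (N C) place _ N-tree⇒N (# 3) (# 4) (# 0) (# 1) (# 2) (# 0) (# 1)
      (opposite-SideOf⇒Gadget (side px) (side pz) (N⇒SideOf (# 3) (# 4) (# 0) px)
        (subst (λ β → SideOf β (place (# 1))) y-opposite (N⇒SideOf (# 3) (# 4) (# 1) py))
        (N⇒SideOf (# 3) (# 4) (# 2) pz))
    where
    open TreeModel (treeModel 4 (x ∷ y ∷ z ∷ a ∷ b ∷ []))
    open Geometry.Poles tree (place (# 3)) (place (# 4))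

  twin⇒Gadget : ∀ {x y z} (px : N C a x b) (py : N C a y b) (pz : N C a z b) →
                      side py ≡ side px → side pz ≡ not (side px) → Σ[ w ∈ L ] Gadget (N C) a b x y z z w
  twin⇒Gadget {x} {y} {z} px py pz y-same z-opposite =
    twin ,
    Gadget-map (N (CT tree)) (N C) place _ N-tree⇒N (# 4) (# 5) (# 1) (# 2) (# 3) (# 3) (# 0)
      (twin-SideOf⇒Gadget (side px) (N⇒SideOf (# 4) (# 5) (# 1) px)
        (subst (λ β → SideOf β (place (# 2))) y-same (N⇒SideOf (# 4) (# 5) (# 2) py))
        (subst (λ β → SideOf β (place (# 3))) z-opposite (N⇒SideOf (# 4) (# 5) (# 3) pz))
        (λ { true → twin-nearest (# 3) ; false → twin-nearest (# 4) }) twin-distinct)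
    where
    open TwinModel (twinModel (treeModel 4 (x ∷ y ∷ z ∷ a ∷ b ∷ [])) (# 2))
    open TreeModel model
    open Geometry.Poles tree (place (# 4)) (place (# 5))

  NAE⇒Gadget : ∀ {x y z} (px : N C a x b) (py : N C a y b) (pz : N C a z b) →
               NAE (side px) (side py) (side pz) → ∃₂ λ v w → Gadget (N C) a b x y z v w
  NAE⇒Gadget {x} {y} {z} px py pz nae with NAE-cases nae
  ... | inj₁ y-opposite            = x , y , separated⇒Gadget px py pz y-opposite
  ... | inj₂ (y-same , z-opposite) = z , twin⇒Gadget px py pz y-same z-opposite

  domainFormula : PP (Fin 1)
  domainFormula = 0 , rel cstA (var (inj₁ zero)) cstB ∷ []

  Domain : Set
  Domain = Σ[ x ∈ (Fin 1 → L) ] ⟦ N C ⟧ a b domainFormula x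

  point : Domain → L
  point u = proj₁ u zero

  inDomain : (u : Domain) → N C a (point u) b
  inDomain (_ , _ , a|x|b ∷ []) = a|x|b

  label : Domain → Bool
  label u = side (inDomain u)

  aPoint bPoint : Domain
  aPoint = (λ _ → a) , (λ ()) , inj₁ (C-distinct a≢b) ∷ []
  bPoint = (λ _ → b) , (λ ()) , inj₂ (C-distinct (a≢b ∘ sym)) ∷ []

  labelled : ∀ β → Σ[ u ∈ Domain ] label u ≡ β
  labelled true  = aPoint , refl
  labelled false = bPoint , refl

  oppositely-labelled : ∀ β → Σ[ u ∈ Domain ] β ≡ not (label u)
  oppositely-labelled true  = bPoint , refl
  oppositely-labelled false = aPoint , refl

  gadgetAtoms : {V : Set} → Term V → Term V → Term V → Term V → Term V → List (Atom V)
  gadgetAtoms x y z v w = rel v z w ∷ rel v w y ∷ rel w cstA x ∷ rel w cstB x ∷ rel w v x ∷ []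

  All-gadgetAtoms⇔Gadget : ∀ {V} {ρ : V → L} (x y z v w : Term V) →
    All (evalAtom (N C) a b ρ) (gadgetAtoms x y z v w) ⇔
    Gadget (N C) a b (evalTerm (N C) a b ρ x) (evalTerm (N C) a b ρ y) (evalTerm (N C) a b ρ z)
                     (evalTerm (N C) a b ρ v) (evalTerm (N C) a b ρ w)
  All-gadgetAtoms⇔Gadget _ _ _ _ _ = mk⇔
    (λ { (vzw ∷ vwy ∷ wax ∷ wbx ∷ wvx ∷ []) → vzw , vwy , wax , wbx , wvx })
    (λ { (vzw , vwy , wax , wbx , wvx) → vzw ∷ vwy ∷ wax ∷ wbx ∷ wvx ∷ [] })

  naeFormula : PP (Fin 3 × Fin 1)
  naeFormula = 2 , gadgetAtoms (var (inj₁ (# 0 , zero))) (var (inj₁ (# 1 , zero))) (var (inj₁ (# 2 , zero)))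
                               (var (inj₂ (# 0))) (var (inj₂ (# 1)))

  naeCorrect : ∀ (u₁ u₂ u₃ : Domain) → NAE (label u₁) (label u₂) (label u₃) ⇔
               ⟦ N C ⟧ a b naeFormula (λ { (i , j) → proj₁ (tuple3 u₁ u₂ u₃ i) j })
  naeCorrect u₁ u₂ u₃ = mk⇔
    (λ nae → let v , w , gadget = NAE⇒Gadget (inDomain u₁) (inDomain u₂) (inDomain u₃) nae
             in lookup (v ∷ w ∷ []) , from (All-gadgetAtoms⇔Gadget _ _ _ _ _) gadget)
    (λ { (_ , atoms) → Gadget⇒NAE (inDomain u₁) (inDomain u₂) (inDomain u₃) (to (All-gadgetAtoms⇔Gadget _ _ _ _ _) atoms) })

  eqFormula : PP (Fin 2 × Fin 1)
  eqFormula = 5 , rel cstA z cstB ∷ gadgetAtoms x₁ z z v₁ w₁ ++ gadgetAtoms x₂ z z v₂ w₂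
    where
    x₁ x₂ z v₁ w₁ v₂ w₂ : Term ((Fin 2 × Fin 1) ⊎ Fin 5)
    x₁ = var (inj₁ (# 0 , zero))
    x₂ = var (inj₁ (# 1 , zero))
    z  = var (inj₂ (# 0))
    v₁ = var (inj₂ (# 1))
    w₁ = var (inj₂ (# 2))
    v₂ = var (inj₂ (# 3))
    w₂ = var (inj₂ (# 4))

  opposite-labels⇒Gadget : ∀ (u z : Domain) → label u ≡ not (label z) →
                    ∃₂ λ v w → Gadget (N C) a b (point u) (point z) (point z) v w
  opposite-labels⇒Gadget u z opposite = NAE⇒Gadget (inDomain u) (inDomain z) (inDomain z) (from NAE-pqq⇔≡not opposite)

  eqCorrect : ∀ (u₁ u₂ : Domain) → (label u₁ ≡ label u₂) ⇔
              ⟦ N C ⟧ a b eqFormula (λ { (i , j) → proj₁ (tuple2 u₁ u₂ i) j })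
  eqCorrect u₁ u₂ = mk⇔ to′ from′
    where
    to′ : label u₁ ≡ label u₂ → ⟦ N C ⟧ a b eqFormula (λ { (i , j) → proj₁ (tuple2 u₁ u₂ i) j })
    to′ same with oppositely-labelled (label u₁)
    ... | z , opposite with opposite-labels⇒Gadget u₁ z opposite | opposite-labels⇒Gadget u₂ z (trans (sym same) opposite)
    ... | v₁ , w₁ , gadget₁ | v₂ , w₂ , gadget₂ =
      lookup (point z ∷ v₁ ∷ w₁ ∷ v₂ ∷ w₂ ∷ []) ,
      inDomain z ∷ ++⁺ (from (All-gadgetAtoms⇔Gadget _ _ _ _ _) gadget₁) (from (All-gadgetAtoms⇔Gadget _ _ _ _ _) gadget₂)
    from′ : ⟦ N C ⟧ a b eqFormula (λ { (i , j) → proj₁ (tuple2 u₁ u₂ i) j }) → label u₁ ≡ label u₂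
    from′ (_ , pz ∷ atoms) with ++⁻ (gadgetAtoms _ _ _ _ _) atoms
    ... | atoms₁ , atoms₂ =
      trans (to NAE-pqq⇔≡not (Gadget⇒NAE (inDomain u₁) pz pz (to (All-gadgetAtoms⇔Gadget _ _ _ _ _) atoms₁)))
            (sym (to NAE-pqq⇔≡not (Gadget⇒NAE (inDomain u₂) pz pz (to (All-gadgetAtoms⇔Gadget _ _ _ _ _) atoms₂))))

  interpretation : PPInterpretsNAE (N C) a b
  interpretation = record
    { d          = 1
    ; δ          = domainFormula
    ; naeI       = naeFormula
    ; eqI        = eqFormula
    ; h          = label
    ; surjective = labelled
    ; naeCorrect = naeCorrect
    ; eqCorrect  = eqCorrect
    }

mainTheorem1 : (L : Set) (C : Rel3 L) → IsHomBinBranchingC L C →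
               (a b : L) → a ≢ b → PPInterpretsNAE (N C) a b
mainTheorem1 L C H a b a≢b = Interpretation.interpretation H a b a≢b
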